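{- Consider the generalized preferential attachment process described in the context, in which each host request is a pair (time $t$, degree $d$) and is fulfilled by choosing a node uniformly at random among the nodes having degree $d$ just before time $t$, after which that node's degree becomes $d+1$. Processing the host requests sorted ascendingly by degree first and by new node (time) second, rather than ascendingly by time, yields the same output distribution.
   Context: General preferential attachment: start from a seed graph $G_0=(V_0,E_0)$ with $n_0$ nodes; nodes $v_{n_0+1},\dots,v_{n_0+N}$ arrive one by one and each is connected to $\ell$ different existing hosts, where a node $h$ of current degree $d$ is chosen as host with probability proportional to $f(d)$ for a given $f\colon \mathbb{N}\to\mathbb{R}_{\ge 0}$. The algorithm first samples, for each new node $v_{n_0+i}$ and each $j \in \{1,\dots,\ell\}$, only the degree $d_j$ of its $j$-th host, producing a host request $\langle v_{n_0+i}, j, d_j\rangle$ with time $t = \ell i + j$. For $M(d,t)$ the set of nodes of degree $d$ after time $t$ (with $M(d,0)$ the seed nodes of degree $d$; a new node $v_{n_0+i}$ enters with degree $\ell$ at time $\ell(i+1)$), a request $\langle v_{n_0+i}, j, d\rangle$ at time $t$ is fulfilled by choosing $u$ uniformly at random from $M(d,t-1)$, connecting $v_{n_0+i}$ to $u$, and setting $M(d,t) = M(d,t-1)\setminus\{u\}$ and $M(d+1,t) = M(d+1,t-1)\cup\{u\}$. -}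

module Defs where

open import Data.Nat using (ℕ; zero; suc; _+_; _*_; _∸_; _≤ᵇ_; _≡ᵇ_; _⊔_)
open import Data.Fin using (Fin; toℕ)
open import Data.Fin.Properties using () renaming (_≟_ to _≟ᶠ_)
open import Data.Sum using (_⊎_; inj₁; inj₂)
open import Data.Product using (_×_; _,_; proj₁; proj₂)
open import Data.Maybe using (Maybe; just; nothing)
open import Data.Bool using (Bool; true; false; _∧_; if_then_else_)
open import Data.List using (List; []; _∷_; map; concat; concatMap; filterᵇ; foldr; length; allFin; upTo; _++_)
open import Data.Bool.ListAction using (and)
open import Data.Rational using (ℚ; 0ℚ; _/_) renaming (_+_ to _+ℚ_; _*_ to _*ℚ_)
open import Data.Integer using (+_)
open import Relation.Nullary.Decidable using (⌊_⌋)

-- Generalised preferential attachment, host-fulfilment phase.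
--   n0   : number of seed nodes, with degrees deg0 (the seed graph enters
--          the fulfilment phase only through the degrees of its nodes)
--   N    : number of arriving nodes
--   ℓ    : number of hosts per arriving node
--   D i j: the sampled host degree of request ⟨v_{n0+i+1}, j+1, D i j⟩
--          (0-based indices i : Fin N, j : Fin ℓ)
module PA (n0 N ℓ : ℕ) (deg0 : Fin n0 → ℕ) (D : Fin N → Fin ℓ → ℕ) where

  -- nodes: seed nodes (inj₁) and new nodes v_{n0+k+1} (inj₂ k)
  Node : Set
  Node = Fin n0 ⊎ Fin N

  _==ᴺ_ : Node → Node → Bool
  inj₁ a ==ᴺ inj₁ b = ⌊ a ≟ᶠ b ⌋
  inj₂ a ==ᴺ inj₂ b = ⌊ a ≟ᶠ b ⌋
  _ ==ᴺ _ = false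

  allNodes : List Node
  allNodes = map inj₁ (allFin n0) ++ map inj₂ (allFin N)

  Req : Set
  Req = Fin N × Fin ℓ

  _==ᴿ_ : Req → Req → Bool
  (i , j) ==ᴿ (i' , j') = ⌊ i ≟ᶠ i' ⌋ ∧ ⌊ j ≟ᶠ j' ⌋

  -- time of request ⟨v_{n0+i}, j, d⟩ is ℓ·i + j (paper's 1-based i, j)
  time : Req → ℕ
  time (i , j) = ℓ * suc (toℕ i) + suc (toℕ j)

  degreeOf : Req → ℕ
  degreeOf (i , j) = D i j

  timeOrder : List Req
  timeOrder = concatMap (λ i → map (λ j → (i , j)) (allFin ℓ)) (allFin N)

  maxDeg : ℕ
  maxDeg = foldr (λ r m → degreeOf r ⊔ m) 0 timeOrder

  sortedOrder : List Req
  sortedOrder = concatMap (λ d → filterᵇ (λ r → degreeOf r ≡ᵇ d) timeOrder)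
                          (upTo (suc maxDeg))

  Assignment : Set
  Assignment = Req → Maybe Node

  isJust= : Maybe Node → Node → Bool
  isJust= (just v) u = v ==ᴺ u
  isJust= nothing  u = false

  hits : Assignment → Node → ℕ → ℕ
  hits a u s = length (filterᵇ (λ r → (time r ≤ᵇ s) ∧ isJust= (a r) u) timeOrder)

  -- u ∈ M(d, s) as computed from the (partial) assignment a:
  -- seed node: degree deg0 + hits; new node v_{n0+k+1} enters with degree ℓ
  -- at time ℓ(k+2) and afterwards has degree ℓ + hits.
  inM : Assignment → ℕ → ℕ → Node → Bool
  inM a d s (inj₁ x) = (deg0 x + hits a (inj₁ x) s) ≡ᵇ d
  inM a d s (inj₂ k) = (ℓ * suc (suc (toℕ k)) ≤ᵇ s) ∧ ((ℓ + hits a (inj₂ k) s) ≡ᵇ d)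

  -- finite sub-probability distributions as weighted lists
  Dist : Set
  Dist = List (Assignment × ℚ)

  update : Assignment → Req → Node → Assignment
  update a r u r' = if r ==ᴿ r' then just u else a r'

  stepOne : Req → Assignment × ℚ → Dist
  stepOne r (a , w) with filterᵇ (inM a (degreeOf r) (time r ∸ 1)) allNodes
  ... | cs@[]      = []
  ... | cs@(_ ∷ xs) = map (λ u → (update a r u , w *ℚ ((+ 1) / suc (length xs)))) cs

  step : Req → Dist → Dist
  step r δ = concatMap (stepOne r) δ

  empty : Assignment
  empty _ = nothing

  run : List Req → Dist
  run rs = foldr step ((empty , (+ 1) / 1) ∷ []) (Data.List.reverse rs)

  -- the output graph (new edges v_{n0+i+1} — host) determined by an assignment:
  -- two assignments give the same graph iff every new node has the same
  -- multiset of hosts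
  countHost : Assignment → Fin N → Node → ℕ
  countHost a i u = length (filterᵇ (λ j → isJust= (a (i , j)) u) (allFin ℓ))

  sameGraph : Assignment → Assignment → Bool
  sameGraph a b = and (concatMap (λ i → map (λ u → countHost a i u ≡ᵇ countHost b i u) allNodes) (allFin N))

  mass : Dist → Assignment → ℚ
  mass δ g = foldr (λ p acc → (if sameGraph (proj₁ p) g then proj₂ p else 0ℚ) +ℚ acc) 0ℚ δ

-- Fulfilling a request r changes the state only by raising the degree of its host u, and
-- a request only looks at degrees just before its own time.  Let r₁ precede r₂ in time with
-- deg r₂ < deg r₁.  Fulfilling r₂ first cannot change the candidates of r₁, since r₁ does not
-- see later hits; fulfilling r₁ first cannot change the candidates of r₂, since u has degree
-- above deg r₁ > deg r₂ from then on and no other node changes.  Hence such adjacent requests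
-- can be swapped without changing the distribution of the output graph (the two orders are the
-- same double sum, with the same product of uniform weights).  Sorting the time order stably by
-- degree is an insertion sort that only performs swaps of this kind.
module Submission where

open import Algebra.Bundles using (CommutativeMonoid)
import Algebra.Properties.CommutativeSemigroup as CommSemigroupProperties
open import Data.Bool using (Bool; true; false; T; _∧_; if_then_else_)
open import Data.Bool.ListAction using (and)
open import Data.Bool.Properties using (T-≡; T-∧; ∧-zeroʳ)
open import Data.Empty using (⊥-elim)
open import Data.Fin as Fin using (Fin; toℕ)
open import Data.Fin.Properties using (toℕ<n) renaming (_≟_ to _≟ᶠ_)
open import Data.Integer using (+_)
open import Data.List
  using (List; []; _∷_; _++_; [_]; _∷ʳ_; map; concatMap; filterᵇ; foldr; length; reverse; allFin; upTo)
open import Data.List.Effectful using (module MonadProperties)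
open import Data.List.Properties
  using ( filter-≐; filter-accept; filter-reject; concatMap-map; concatMap-pure; concatMap-cong
        ; map-cong; foldr-++; unfold-reverse; ++-identityʳ; upTo-∷ʳ)
open import Data.List.Relation.Binary.Sublist.Propositional using (⊆-refl)
import Data.List.Relation.Binary.Sublist.Propositional.Properties as Sublist
open import Data.List.Relation.Unary.All as All using (All; []; _∷_)
import Data.List.Relation.Unary.All.Properties as All
open import Data.List.Relation.Unary.All.Properties using (all-filter; filter⁺; ∷ʳ⁺; applyUpTo⁺₁)
open import Data.List.Relation.Unary.AllPairs using (AllPairs; []; _∷_)
import Data.List.Relation.Unary.AllPairs.Properties as AllPairs
open import Data.Maybe using (just; nothing)
open import Data.Nat using (ℕ; suc; s≤s; s≤s⁻¹; z<s; _+_; _*_; _∸_; _≤_; _<_; _≤ᵇ_; _≡ᵇ_; _⊔_)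
open import Data.Nat.Properties
  using ( +-comm; +-suc; *-suc; +-monoʳ-≤; +-monoʳ-<; *-monoʳ-≤; m<m+n; m∸n≤m; pred-mono-≤
        ; m≤m⊔n; m≤n⊔m; ≤-reflexive; ≤-trans; ≤-<-trans; <⇒≤; <-irrefl; <⇒≢; >⇒≢; n<1+n
        ; m≤n⇒m<n∨m≡n; ≤ᵇ⇒≤; ≤⇒≤ᵇ; ≡ᵇ⇒≡; ≡⇒≡ᵇ; module ≤-Reasoning)
open import Data.Product using (_×_; _,_; proj₁; proj₂)
open import Data.Rational using (ℚ; 0ℚ; _/_) renaming (_+_ to _+ℚ_; _*_ to _*ℚ_)
import Data.Rational.Properties as ℚ
open import Data.Sum using (inj₁; inj₂)
open import Function using (_∘_; Equivalence)
open import Relation.Binary.PropositionalEquality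
  using (_≡_; _≢_; refl; sym; trans; cong; cong₂; subst; _≗_; module ≡-Reasoning)
open import Relation.Nullary using (contradiction)
open import Relation.Nullary.Decidable using (T?; toWitness; ⌊_⌋)

open import Defs

open CommSemigroupProperties (CommutativeMonoid.commutativeSemigroup ℚ.+-0-commutativeMonoid)
  using (interchange)
module ℚ* = CommSemigroupProperties (CommutativeMonoid.commutativeSemigroup ℚ.*-1-commutativeMonoid)

private
  variable
    A B : Set

filterᵇ-cong : {p q : A → Bool} → p ≗ q → filterᵇ p ≗ filterᵇ q
filterᵇ-cong {p = p} {q = q} p≗q =
  filter-≐ (T? ∘ p) (T? ∘ q) ((λ {x} → subst T (p≗q x)) , (λ {x} → subst T (sym (p≗q x))))

length-filterᵇ-mono : {p q : A → Bool} → (∀ {x} → T (p x) → T (q x)) →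
                      ∀ xs → length (filterᵇ p xs) ≤ length (filterᵇ q xs)
length-filterᵇ-mono {p = p} {q = q} p⇒q xs =
  Sublist.length-mono-≤ (Sublist.filter⁺ (T? ∘ p) (T? ∘ q) (λ { refl → p⇒q }) (⊆-refl {x = xs}))

≤-foldr-⊔ : (f : A → ℕ) (xs : List A) → All (λ x → f x ≤ foldr (λ y m → f y ⊔ m) 0 xs) xs
≤-foldr-⊔ f []       = []
≤-foldr-⊔ f (x ∷ xs) =
  m≤m⊔n (f x) _ ∷ All.map (λ le → ≤-trans le (m≤n⊔m (f x) _)) (≤-foldr-⊔ f xs)

data InsertionPoint (d : ℕ) : List ℕ → Set where
  here  : ∀ {es} → All (_≢ d) es → InsertionPoint d (d ∷ es)
  there : ∀ {e es} → e < d → InsertionPoint d es → InsertionPoint d (e ∷ es)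

insertionPoint-∷ʳ : ∀ {d e es} → InsertionPoint d es → e ≢ d → InsertionPoint d (es ∷ʳ e)
insertionPoint-∷ʳ (here e≢s)   e≢d = here (∷ʳ⁺ e≢s e≢d)
insertionPoint-∷ʳ (there e<d p) e≢d = there e<d (insertionPoint-∷ʳ p e≢d)

insertionPoint-last : ∀ {d es} → All (_< d) es → InsertionPoint d (es ∷ʳ d)
insertionPoint-last []           = here []
insertionPoint-last (e<d ∷ e<ds) = there e<d (insertionPoint-last e<ds)

insertionPoint-upTo : ∀ {d n} → d < n → InsertionPoint d (upTo n)
insertionPoint-upTo {d} {suc n} d<1+n with m≤n⇒m<n∨m≡n (s≤s⁻¹ d<1+n)
... | inj₁ d<n  =
  subst (InsertionPoint d) (upTo-∷ʳ n) (insertionPoint-∷ʳ (insertionPoint-upTo d<n) (>⇒≢ d<n))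
... | inj₂ refl =
  subst (InsertionPoint d) (upTo-∷ʳ d) (insertionPoint-last (applyUpTo⁺₁ _ d (λ i<d → i<d)))

∑ : (A → ℚ) → List A → ℚ
∑ f = foldr (λ x s → f x +ℚ s) 0ℚ

∑-congᴬ : {f f' : A → ℚ} {xs : List A} → All (λ x → f x ≡ f' x) xs → ∑ f xs ≡ ∑ f' xs
∑-congᴬ []       = refl
∑-congᴬ (e ∷ es) = cong₂ _+ℚ_ e (∑-congᴬ es)

∑-cong : {f f' : A → ℚ} → f ≗ f' → (xs : List A) → ∑ f xs ≡ ∑ f' xs
∑-cong f≗f' xs = ∑-congᴬ (All.universal f≗f' xs)

∑-zero : (xs : List A) → ∑ (λ _ → 0ℚ) xs ≡ 0ℚ
∑-zero []       = refl
∑-zero (x ∷ xs) = trans (cong (0ℚ +ℚ_) (∑-zero xs)) (ℚ.+-identityˡ 0ℚ)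

∑-+ : (f h : A → ℚ) (xs : List A) → ∑ (λ x → f x +ℚ h x) xs ≡ ∑ f xs +ℚ ∑ h xs
∑-+ f h []       = sym (ℚ.+-identityˡ 0ℚ)
∑-+ f h (x ∷ xs) =
  trans (cong (f x +ℚ h x +ℚ_) (∑-+ f h xs)) (interchange (f x) (h x) (∑ f xs) (∑ h xs))

∑-++ : (f : A → ℚ) (xs ys : List A) → ∑ f (xs ++ ys) ≡ ∑ f xs +ℚ ∑ f ys
∑-++ f []       ys = sym (ℚ.+-identityˡ _)
∑-++ f (x ∷ xs) ys = trans (cong (f x +ℚ_) (∑-++ f xs ys)) (sym (ℚ.+-assoc (f x) _ _))

∑-concatMap : (f : B → ℚ) (h : A → List B) (xs : List A) →
              ∑ f (concatMap h xs) ≡ ∑ (λ x → ∑ f (h x)) xs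
∑-concatMap f h []       = refl
∑-concatMap f h (x ∷ xs) =
  trans (∑-++ f (h x) (concatMap h xs)) (cong (∑ f (h x) +ℚ_) (∑-concatMap f h xs))

∑-comm : (G : A → B → ℚ) (xs : List A) (ys : List B) →
         ∑ (λ x → ∑ (G x) ys) xs ≡ ∑ (λ y → ∑ (λ x → G x y) xs) ys
∑-comm G []       ys = sym (∑-zero ys)
∑-comm G (x ∷ xs) ys =
  trans (cong (∑ (G x) ys +ℚ_) (∑-comm G xs ys)) (sym (∑-+ (G x) (λ y → ∑ (λ x' → G x' y) xs) ys))

module Fulfilment (n0 N ℓ : ℕ) (deg0 : Fin n0 → ℕ) (D : Fin N → Fin ℓ → ℕ) where

  open PA n0 N ℓ deg0 D

  ==ᴿ⇒≡ : ∀ r r' → T (r ==ᴿ r') → r ≡ r'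
  ==ᴿ⇒≡ (i , j) (i' , j') t with i≡i' , j≡j' ← Equivalence.to (T-∧ {⌊ i ≟ᶠ i' ⌋}) t =
    cong₂ _,_ (toWitness i≡i') (toWitness j≡j')

  ==ᴺ⇒≡ : ∀ u v → T (u ==ᴺ v) → u ≡ v
  ==ᴺ⇒≡ (inj₁ x) (inj₁ y) t = cong inj₁ (toWitness t)
  ==ᴺ⇒≡ (inj₂ x) (inj₂ y) t = cong inj₂ (toWitness t)
  ==ᴺ⇒≡ (inj₁ x) (inj₂ y) ()
  ==ᴺ⇒≡ (inj₂ x) (inj₁ y) ()

  time∸1<time : ∀ r → time r ∸ 1 < time r
  time∸1<time (i , j) rewrite +-suc (ℓ * suc (toℕ i)) (toℕ j) = n<1+n _

  update-elsewhere : ∀ a {r r'} u → r ≢ r' → update a r u r' ≡ a r'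
  update-elsewhere a {r} {r'} u r≢r' with r ==ᴿ r' in eq
  ... | true  = contradiction (==ᴿ⇒≡ r r' (Equivalence.from T-≡ eq)) r≢r'
  ... | false = refl

  update-≗ : ∀ {a b} → a ≗ b → ∀ r u → update a r u ≗ update b r u
  update-≗ a≗b r u r' = cong (λ m → if r ==ᴿ r' then just u else m) (a≗b r')

  update-comm : ∀ a {r₁ r₂} u₁ u₂ → r₁ ≢ r₂ →
                update (update a r₁ u₁) r₂ u₂ ≗ update (update a r₂ u₂) r₁ u₁
  update-comm a {r₁} {r₂} u₁ u₂ r₁≢r₂ r with r₂ ==ᴿ r in eq₂ | r₁ ==ᴿ r in eq₁
  ... | true  | true  = contradiction (trans (==ᴿ⇒≡ r₁ r (Equivalence.from T-≡ eq₁))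
                                             (sym (==ᴿ⇒≡ r₂ r (Equivalence.from T-≡ eq₂)))) r₁≢r₂
  ... | true  | false = refl
  ... | false | true  = refl
  ... | false | false = refl

  Pending : Assignment → Req → Set
  Pending a r = a r ≡ nothing

  update-pending : ∀ a {r r'} u → r ≢ r' → Pending a r' → Pending (update a r u) r'
  update-pending a u r≢r' pending = trans (update-elsewhere a u r≢r') pending

  hits-cong : ∀ a b v s → (∀ r → time r ≤ s → isJust= (a r) v ≡ isJust= (b r) v) →
              hits a v s ≡ hits b v s
  hits-cong a b v s agree = cong length (filterᵇ-cong pointwise timeOrder)
    where
    pointwise : ∀ r → ((time r ≤ᵇ s) ∧ isJust= (a r) v) ≡ ((time r ≤ᵇ s) ∧ isJust= (b r) v)
    pointwise r with time r ≤ᵇ s in le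
    ... | false = refl
    ... | true  = agree r (≤ᵇ⇒≤ _ _ (Equivalence.from T-≡ le))

  hits-≗ : ∀ {a b} → a ≗ b → ∀ v s → hits a v s ≡ hits b v s
  hits-≗ {a} {b} a≗b v s = hits-cong a b v s (λ r _ → cong (λ m → isJust= m v) (a≗b r))

  hits-update-future : ∀ a {r} u v {s} → s < time r → hits (update a r u) v s ≡ hits a v s
  hits-update-future a {r} u v {s} s<t = hits-cong (update a r u) a v s λ r' t'≤s →
    cong (λ m → isJust= m v) (update-elsewhere a u (>⇒≢ (≤-<-trans t'≤s s<t) ∘ cong time))

  hits-update-elsewhere : ∀ a {r} u v s → Pending a r → (u ==ᴺ v) ≡ false →
                          hits (update a r u) v s ≡ hits a v s
  hits-update-elsewhere a {r} u v s pending u≠v =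
    hits-cong (update a r u) a v s (λ r' _ → pointwise r')
    where
    pointwise : ∀ r' → isJust= (update a r u r') v ≡ isJust= (a r') v
    pointwise r' with r ==ᴿ r' in eq
    ... | false = refl
    ... | true with refl ← ==ᴿ⇒≡ r r' (Equivalence.from T-≡ eq) =
      trans u≠v (cong (λ m → isJust= m v) (sym pending))

  hits-mono : ∀ a v {s s'} → s ≤ s' → hits a v s ≤ hits a v s'
  hits-mono a v {s} {s'} s≤s' = length-filterᵇ-mono counted timeOrder
    where
    counted : ∀ {r} → T ((time r ≤ᵇ s) ∧ isJust= (a r) v) → T ((time r ≤ᵇ s') ∧ isJust= (a r) v)
    counted {r} t with t≤s , hit ← Equivalence.to (T-∧ {time r ≤ᵇ s}) t =
      Equivalence.from (T-∧ {time r ≤ᵇ s'}) (≤⇒≤ᵇ (≤-trans (≤ᵇ⇒≤ (time r) s t≤s) s≤s') , hit)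

  inM-cong : ∀ {a b} d s v → hits a v s ≡ hits b v s → inM a d s v ≡ inM b d s v
  inM-cong d s (inj₁ x) eq = cong (λ h → (deg0 x + h) ≡ᵇ d) eq
  inM-cong d s (inj₂ k) eq = cong (λ h → (ℓ * suc (suc (toℕ k)) ≤ᵇ s) ∧ ((ℓ + h) ≡ᵇ d)) eq

  ≡ᵇ-false-below : ∀ base {h h' d d'} → T (base + h ≡ᵇ d) → d' < d → h ≤ h' →
                   (base + h' ≡ᵇ d') ≡ false
  ≡ᵇ-false-below base {h} {h'} {d} {d'} deg≡d d'<d h≤h' with base + h' ≡ᵇ d' in eq
  ... | false = refl
  ... | true  = ⊥-elim (<-irrefl refl d<d)
    where
    open ≤-Reasoning
    d<d : d < d
    d<d = begin-strict
      d         ≡⟨ ≡ᵇ⇒≡ _ _ deg≡d ⟨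
      base + h  ≤⟨ +-monoʳ-≤ base h≤h' ⟩
      base + h' ≡⟨ ≡ᵇ⇒≡ _ _ (Equivalence.from T-≡ eq) ⟩
      d'        <⟨ d'<d ⟩
      d         ∎

  inM-false-below : ∀ a b u {d d' s s'} → T (inM a d s u) → d' < d → hits a u s ≤ hits b u s' →
                    inM b d' s' u ≡ false
  inM-false-below a b (inj₁ x) u∈ d'<d h≤h' = ≡ᵇ-false-below (deg0 x) u∈ d'<d h≤h'
  inM-false-below a b (inj₂ k) {s = s} {s'} u∈ d'<d h≤h'
    with _ , deg≡d ← Equivalence.to (T-∧ {ℓ * suc (suc (toℕ k)) ≤ᵇ s}) u∈ =
    trans (cong (entered ∧_) (≡ᵇ-false-below ℓ deg≡d d'<d h≤h')) (∧-zeroʳ entered)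
    where
    entered : Bool
    entered = ℓ * suc (suc (toℕ k)) ≤ᵇ s'

  candidates : Assignment → Req → List Node
  candidates a r = filterᵇ (inM a (degreeOf r) (time r ∸ 1)) allNodes

  candidates-≗ : ∀ {a b} → a ≗ b → ∀ r → candidates a r ≡ candidates b r
  candidates-≗ a≗b r = filterᵇ-cong (λ v → inM-cong _ _ v (hits-≗ a≗b v _)) allNodes

  candidates-update-later : ∀ a {r r'} u → time r' < time r →
                            candidates (update a r u) r' ≡ candidates a r'
  candidates-update-later a {r' = r'} u t'<t = filterᵇ-cong
    (λ v → inM-cong _ _ v (hits-update-future a u v (≤-<-trans (m∸n≤m (time r') 1) t'<t)))
    allNodes

  -- The host u of r leaves degree degreeOf r for good, so it cannot be a candidate of a
  -- later request of smaller degree; every other node keeps its hits.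
  candidates-update-higher : ∀ a {r r' u} → Pending a r → time r < time r' →
                             degreeOf r' < degreeOf r → T (inM a (degreeOf r) (time r ∸ 1) u) →
                             candidates (update a r u) r' ≡ candidates a r'
  candidates-update-higher a {r} {r'} {u} pending t<t' d'<d u∈ = filterᵇ-cong unaffected allNodes
    where
    s≤s' : time r ∸ 1 ≤ time r' ∸ 1
    s≤s' = pred-mono-≤ (<⇒≤ t<t')
    unaffected : ∀ v → inM (update a r u) (degreeOf r') (time r' ∸ 1) v ≡
                       inM a (degreeOf r') (time r' ∸ 1) v
    unaffected v with u ==ᴺ v in eq
    ... | false = inM-cong _ _ v (hits-update-elsewhere a u v _ pending eq)
    ... | true with refl ← ==ᴺ⇒≡ u v (Equivalence.from T-≡ eq) =
      trans (inM-false-below a (update a r u) u u∈ d'<d hits-grow)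
            (sym (inM-false-below a a u u∈ d'<d (hits-mono a u s≤s')))
      where
      hits-grow : hits a u (time r ∸ 1) ≤ hits (update a r u) u (time r' ∸ 1)
      hits-grow = ≤-trans (≤-reflexive (sym (hits-update-future a u u (time∸1<time r))))
                          (hits-mono (update a r u) u s≤s')

  uniform : List Node → ℚ
  uniform []       = 0ℚ
  uniform (_ ∷ us) = + 1 / suc (length us)

  stepOne-candidates : ∀ r a w →
    stepOne r (a , w) ≡ map (λ u → update a r u , w *ℚ uniform (candidates a r)) (candidates a r)
  stepOne-candidates r a w with filterᵇ (inM a (degreeOf r) (time r ∸ 1)) allNodes
  ... | []    = refl
  ... | _ ∷ _ = refl

  outcomes : Assignment × ℚ → List Req → Dist
  outcomes s []       = s ∷ []
  outcomes s (r ∷ rs) = concatMap (λ s' → outcomes s' rs) (stepOne r s)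

  run-outcomes : ∀ rs δ → foldr step δ (reverse rs) ≡ concatMap (λ s → outcomes s rs) δ
  run-outcomes []       δ = sym (concatMap-pure δ)
  run-outcomes (r ∷ rs) δ = begin
    foldr step δ (reverse (r ∷ rs))
      ≡⟨ cong (foldr step δ) (unfold-reverse r rs) ⟩
    foldr step δ (reverse rs ++ [ r ])
      ≡⟨ foldr-++ step δ (reverse rs) [ r ] ⟩
    foldr step (step r δ) (reverse rs)
      ≡⟨ run-outcomes rs (step r δ) ⟩
    concatMap (λ s → outcomes s rs) (concatMap (stepOne r) δ)
      ≡⟨ MonadProperties.associative δ (stepOne r) _ ⟨
    concatMap (λ s → outcomes s (r ∷ rs)) δ
      ∎
    where open ≡-Reasoning

  countHost-≗ : ∀ {a b} → a ≗ b → ∀ i u → countHost a i u ≡ countHost b i u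
  countHost-≗ a≗b i u =
    cong length (filterᵇ-cong (λ j → cong (λ m → isJust= m u) (a≗b (i , j))) (allFin ℓ))

  sameGraph-≗ : ∀ {a b} → a ≗ b → ∀ g → sameGraph a g ≡ sameGraph b g
  sameGraph-≗ a≗b g = cong and (concatMap-cong
    (λ i → map-cong (λ u → cong (_≡ᵇ countHost g i u) (countHost-≗ a≗b i u)) allNodes) (allFin N))

  hasDegree : ℕ → Req → Bool
  hasDegree d r = degreeOf r ≡ᵇ d

  block : ℕ → List Req → List Req
  block d = filterᵇ (hasDegree d)

  blocks : List ℕ → List Req → List Req
  blocks ds rs = concatMap (λ d → block d rs) ds

  blocks-skip : ∀ x xs ds → All (_≢ degreeOf x) ds → blocks ds (x ∷ xs) ≡ blocks ds xs
  blocks-skip x xs []       []         = refl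
  blocks-skip x xs (d ∷ ds) (d≢ ∷ d≢s) =
    cong₂ _++_ (filter-reject (T? ∘ hasDegree d) (d≢ ∘ sym ∘ ≡ᵇ⇒≡ _ _)) (blocks-skip x xs ds d≢s)

  time-<-row : ∀ i i' j j' → toℕ i < toℕ i' → time (i , j) < time (i' , j')
  time-<-row i i' j j' i<i' = begin-strict
    ℓ * suc (toℕ i) + suc (toℕ j) ≤⟨ +-monoʳ-≤ (ℓ * suc (toℕ i)) (toℕ<n j) ⟩
    ℓ * suc (toℕ i) + ℓ           ≡⟨ +-comm (ℓ * suc (toℕ i)) ℓ ⟩
    ℓ + ℓ * suc (toℕ i)           ≡⟨ *-suc ℓ (suc (toℕ i)) ⟨
    ℓ * suc (suc (toℕ i))         ≤⟨ *-monoʳ-≤ ℓ (s≤s i<i') ⟩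
    ℓ * suc (toℕ i')              <⟨ m<m+n (ℓ * suc (toℕ i')) z<s ⟩
    ℓ * suc (toℕ i') + suc (toℕ j') ∎
    where open ≤-Reasoning

  timeOrder-increasing : AllPairs (λ r r' → time r < time r') timeOrder
  timeOrder-increasing = AllPairs.concat⁺
    (All.map⁺ (All.universal within-row (allFin N)))
    (AllPairs.map⁺ (AllPairs.tabulate⁺-< across-rows))
    where
    within-row : ∀ i → AllPairs (λ r r' → time r < time r') (map (i ,_) (allFin ℓ))
    within-row i = AllPairs.map⁺ (AllPairs.tabulate⁺-< (+-monoʳ-< (ℓ * suc (toℕ i)) ∘ s≤s))
    across-rows : ∀ {i i'} → i Fin.< i' →
                  All (λ r → All (λ r' → time r < time r') (map (i' ,_) (allFin ℓ)))
                      (map (i ,_) (allFin ℓ))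
    across-rows {i} {i'} i<i' = All.map⁺ (All.universal
      (λ j → All.map⁺ (All.universal (λ j' → time-<-row i i' j j' i<i') (allFin ℓ))) (allFin ℓ))

  insertionPoints : All (λ r → InsertionPoint (degreeOf r) (upTo (suc maxDeg))) timeOrder
  insertionPoints = All.map (insertionPoint-upTo ∘ s≤s) (≤-foldr-⊔ degreeOf timeOrder)

  empty-pending : ∀ rs → All (Pending empty) rs
  empty-pending = All.universal (λ _ → refl)

  module _ (g : Assignment) where

    weight : Assignment × ℚ → ℚ
    weight p = if sameGraph (proj₁ p) g then proj₂ p else 0ℚ

    massFrom : List Req → Assignment → ℚ → ℚ
    massFrom rs a w = mass (outcomes (a , w) rs) g

    massFrom-∷ : ∀ r rs a w → massFrom (r ∷ rs) a w ≡
                 ∑ (λ u → massFrom rs (update a r u) (w *ℚ uniform (candidates a r))) (candidates a r)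
    massFrom-∷ r rs a w = begin
      ∑ weight (concatMap next (stepOne r (a , w)))  ≡⟨ cong (∑ weight ∘ concatMap next) (stepOne-candidates r a w) ⟩
      ∑ weight (concatMap next (map branch C))       ≡⟨ cong (∑ weight) (concatMap-map next branch C) ⟩
      ∑ weight (concatMap (next ∘ branch) C)         ≡⟨ ∑-concatMap weight (next ∘ branch) C ⟩
      ∑ (λ u → massFrom rs (update a r u) (w *ℚ uniform C)) C ∎
      where
      open ≡-Reasoning
      C : List Node
      C = candidates a r
      next : Assignment × ℚ → Dist
      next s = outcomes s rs
      branch : Node → Assignment × ℚ
      branch u = update a r u , w *ℚ uniform C

    massFrom-≗ : ∀ rs {a b} w → a ≗ b → massFrom rs a w ≡ massFrom rs b w
    massFrom-≗ []       w a≗b rewrite sameGraph-≗ a≗b g = refl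
    massFrom-≗ (r ∷ rs) {a} {b} w a≗b = begin
      massFrom (r ∷ rs) a w                                              ≡⟨ massFrom-∷ r rs a w ⟩
      ∑ (λ u → massFrom rs (update a r u) (w *ℚ uniform (candidates a r))) (candidates a r)
        ≡⟨ ∑-cong (λ u → massFrom-≗ rs _ (update-≗ a≗b r u)) (candidates a r) ⟩
      ∑ (λ u → massFrom rs (update b r u) (w *ℚ uniform (candidates a r))) (candidates a r)
        ≡⟨ cong (λ C → ∑ (λ u → massFrom rs (update b r u) (w *ℚ uniform C)) C)
                (candidates-≗ a≗b r) ⟩
      ∑ (λ u → massFrom rs (update b r u) (w *ℚ uniform (candidates b r))) (candidates b r)
        ≡⟨ massFrom-∷ r rs b w ⟨
      massFrom (r ∷ rs) b w                                              ∎
      where open ≡-Reasoning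

    infix 4 _≈[_]_
    _≈[_]_ : List Req → Assignment → List Req → Set
    rs ≈[ a ] rs' = ∀ w → massFrom rs a w ≡ massFrom rs' a w

    ≈-∷ : ∀ r rs rs' a → (∀ u → rs ≈[ update a r u ] rs') → r ∷ rs ≈[ a ] r ∷ rs'
    ≈-∷ r rs rs' a rs≈rs' w = begin
      massFrom (r ∷ rs) a w                              ≡⟨ massFrom-∷ r rs a w ⟩
      ∑ (λ u → massFrom rs (update a r u) (w *ℚ p)) C    ≡⟨ ∑-cong (λ u → rs≈rs' u (w *ℚ p)) C ⟩
      ∑ (λ u → massFrom rs' (update a r u) (w *ℚ p)) C   ≡⟨ massFrom-∷ r rs' a w ⟨
      massFrom (r ∷ rs') a w                             ∎
      where
      open ≡-Reasoning
      C : List Node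
      C = candidates a r
      p : ℚ
      p = uniform C

    swap : ∀ {r₁ r₂} rs a → Pending a r₁ → time r₁ < time r₂ → degreeOf r₂ < degreeOf r₁ →
           r₁ ∷ r₂ ∷ rs ≈[ a ] r₂ ∷ r₁ ∷ rs
    swap {r₁} {r₂} rs a pending₁ t₁<t₂ d₂<d₁ w = begin
      massFrom (r₁ ∷ r₂ ∷ rs) a w
        ≡⟨ massFrom-∷ r₁ (r₂ ∷ rs) a w ⟩
      ∑ (λ u₁ → massFrom (r₂ ∷ rs) (update a r₁ u₁) (w *ℚ p₁)) C₁
        ≡⟨ ∑-congᴬ (All.map r₁-first (all-filter (T? ∘ inM a (degreeOf r₁) (time r₁ ∸ 1)) allNodes)) ⟩
      ∑ (λ u₁ → ∑ (λ u₂ → massFrom rs (update (update a r₁ u₁) r₂ u₂) (w *ℚ p₁ *ℚ p₂)) C₂) C₁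
        ≡⟨ ∑-comm (λ u₁ u₂ → massFrom rs (update (update a r₁ u₁) r₂ u₂) (w *ℚ p₁ *ℚ p₂)) C₁ C₂ ⟩
      ∑ (λ u₂ → ∑ (λ u₁ → massFrom rs (update (update a r₁ u₁) r₂ u₂) (w *ℚ p₁ *ℚ p₂)) C₁) C₂
        ≡⟨ ∑-cong (λ u₂ → ∑-cong (λ u₁ → reorder u₁ u₂) C₁) C₂ ⟩
      ∑ (λ u₂ → ∑ (λ u₁ → massFrom rs (update (update a r₂ u₂) r₁ u₁) (w *ℚ p₂ *ℚ p₁)) C₁) C₂
        ≡⟨ ∑-cong r₂-first C₂ ⟨
      ∑ (λ u₂ → massFrom (r₁ ∷ rs) (update a r₂ u₂) (w *ℚ p₂)) C₂
        ≡⟨ massFrom-∷ r₂ (r₁ ∷ rs) a w ⟨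
      massFrom (r₂ ∷ r₁ ∷ rs) a w
        ∎
      where
      open ≡-Reasoning
      C₁ C₂ : List Node
      C₁ = candidates a r₁
      C₂ = candidates a r₂
      p₁ p₂ : ℚ
      p₁ = uniform C₁
      p₂ = uniform C₂
      r₁-first : ∀ {u₁} → T (inM a (degreeOf r₁) (time r₁ ∸ 1) u₁) →
                 massFrom (r₂ ∷ rs) (update a r₁ u₁) (w *ℚ p₁) ≡
                 ∑ (λ u₂ → massFrom rs (update (update a r₁ u₁) r₂ u₂) (w *ℚ p₁ *ℚ p₂)) C₂
      r₁-first {u₁} u₁∈C₁ = trans (massFrom-∷ r₂ rs (update a r₁ u₁) (w *ℚ p₁))
        (cong (λ C → ∑ (λ u₂ → massFrom rs (update (update a r₁ u₁) r₂ u₂) (w *ℚ p₁ *ℚ uniform C)) C)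
              (candidates-update-higher a pending₁ t₁<t₂ d₂<d₁ u₁∈C₁))
      r₂-first : ∀ u₂ → massFrom (r₁ ∷ rs) (update a r₂ u₂) (w *ℚ p₂) ≡
                 ∑ (λ u₁ → massFrom rs (update (update a r₂ u₂) r₁ u₁) (w *ℚ p₂ *ℚ p₁)) C₁
      r₂-first u₂ = trans (massFrom-∷ r₁ rs (update a r₂ u₂) (w *ℚ p₂))
        (cong (λ C → ∑ (λ u₁ → massFrom rs (update (update a r₂ u₂) r₁ u₁) (w *ℚ p₂ *ℚ uniform C)) C)
              (candidates-update-later a u₂ t₁<t₂))
      reorder : ∀ u₁ u₂ → massFrom rs (update (update a r₁ u₁) r₂ u₂) (w *ℚ p₁ *ℚ p₂) ≡
                          massFrom rs (update (update a r₂ u₂) r₁ u₁) (w *ℚ p₂ *ℚ p₁)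
      reorder u₁ u₂ = trans (massFrom-≗ rs _ (update-comm a u₁ u₂ (<⇒≢ t₁<t₂ ∘ cong time)))
                            (cong (massFrom rs (update (update a r₂ u₂) r₁ u₁)) (ℚ*.xy∙z≈xz∙y w p₁ p₂))

    bubble : ∀ x ys zs a → All (λ y → time x < time y × degreeOf y < degreeOf x) ys → Pending a x →
             x ∷ ys ++ zs ≈[ a ] ys ++ x ∷ zs
    bubble x []       zs a []                   pending w = refl
    bubble x (y ∷ ys) zs a ((t<t' , d'<d) ∷ ps) pending w =
      trans (swap (ys ++ zs) a pending t<t' d'<d w)
            (≈-∷ y (x ∷ ys ++ zs) (ys ++ x ∷ zs) a bubble-rest w)
      where
      bubble-rest : ∀ u → x ∷ ys ++ zs ≈[ update a y u ] ys ++ x ∷ zs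
      bubble-rest u = bubble x ys zs (update a y u) ps (update-pending a u (>⇒≢ t<t' ∘ cong time) pending)

    ≈-++ˡ : ∀ x F ys zs a → All (_≢ x) F →
            (∀ a' → Pending a' x → ys ≈[ a' ] zs) → Pending a x → F ++ ys ≈[ a ] F ++ zs
    ≈-++ˡ x []      ys zs a []         ys≈zs pending = ys≈zs a pending
    ≈-++ˡ x (r ∷ F) ys zs a (r≢x ∷ F≢x) ys≈zs pending =
      ≈-∷ r (F ++ ys) (F ++ zs) a
        (λ u → ≈-++ˡ x F ys zs (update a r u) F≢x ys≈zs (update-pending a u r≢x pending))

    insert-blocks : ∀ x xs → All (λ y → time x < time y) xs →
                    ∀ ds → InsertionPoint (degreeOf x) ds → ∀ a → Pending a x → x ∷ blocks ds xs ≈[ a ] blocks ds (x ∷ xs)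
    insert-blocks x xs x<xs (_ ∷ ds) (here d≢s) a pending w =
      cong (λ L → massFrom L a w)
        (sym (cong₂ _++_ (filter-accept (T? ∘ hasDegree (degreeOf x)) (≡⇒≡ᵇ (degreeOf x) _ refl))
                         (blocks-skip x xs ds d≢s)))
    insert-blocks x xs x<xs (e ∷ ds) (there e<d p) a pending w = begin
      massFrom (x ∷ E ++ blocks ds xs) a w
        ≡⟨ bubble x E (blocks ds xs) a later-lower pending w ⟩
      massFrom (E ++ x ∷ blocks ds xs) a w
        ≡⟨ ≈-++ˡ x E (x ∷ blocks ds xs) (blocks ds (x ∷ xs)) a
                 (All.map (λ (x<y , _) → >⇒≢ x<y ∘ cong time) later-lower)
                 (insert-blocks x xs x<xs ds p) pending w ⟩
      massFrom (E ++ blocks ds (x ∷ xs)) a w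
        ≡⟨ cong (λ L → massFrom (L ++ blocks ds (x ∷ xs)) a w)
                (filter-reject (T? ∘ hasDegree e) (>⇒≢ e<d ∘ ≡ᵇ⇒≡ _ _)) ⟨
      massFrom (blocks (e ∷ ds) (x ∷ xs)) a w
        ∎
      where
      open ≡-Reasoning
      E : List Req
      E = block e xs
      later-lower : All (λ y → time x < time y × degreeOf y < degreeOf x) E
      later-lower =
        All.map (λ (x<y , deg≡e) → x<y , subst (_< degreeOf x) (sym (≡ᵇ⇒≡ _ _ deg≡e)) e<d)
                (All.zip (filter⁺ (T? ∘ hasDegree e) x<xs , all-filter (T? ∘ hasDegree e) xs))

    ≈-blocks : ∀ ds xs → AllPairs (λ x y → time x < time y) xs →
               All (λ x → InsertionPoint (degreeOf x) ds) xs →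
               ∀ a → All (Pending a) xs → xs ≈[ a ] blocks ds xs
    ≈-blocks ds []       []           []       a []               w =
      cong (λ L → massFrom L a w) (sym (MonadProperties.right-zero ds))
    ≈-blocks ds (x ∷ xs) (x<xs ∷ ord) (p ∷ ps) a (pending ∷ pendings) w =
      trans (≈-∷ x xs (blocks ds xs) a sort-rest w) (insert-blocks x xs x<xs ds p a pending w)
      where
      sort-rest : ∀ u → xs ≈[ update a x u ] blocks ds xs
      sort-rest u = ≈-blocks ds xs ord ps (update a x u)
        (All.zipWith (λ (x<y , pending-y) → update-pending a u (<⇒≢ x<y ∘ cong time) pending-y)
                     (x<xs , pendings))

    mass-run : ∀ rs → mass (run rs) g ≡ massFrom rs empty (+ 1 / 1)
    mass-run rs = cong (λ δ → mass δ g) (trans (run-outcomes rs _) (++-identityʳ _))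

    timeOrder≈sortedOrder : timeOrder ≈[ empty ] sortedOrder
    timeOrder≈sortedOrder =
      ≈-blocks (upTo (suc maxDeg)) timeOrder timeOrder-increasing insertionPoints
               empty (empty-pending timeOrder)

lemma4p1 : (n0 N ℓ : ℕ) (deg0 : Fin n0 → ℕ) (D : Fin N → Fin ℓ → ℕ)
           (g : PA.Assignment n0 N ℓ deg0 D) →
           PA.mass n0 N ℓ deg0 D (PA.run n0 N ℓ deg0 D (PA.timeOrder n0 N ℓ deg0 D)) g
           ≡ PA.mass n0 N ℓ deg0 D (PA.run n0 N ℓ deg0 D (PA.sortedOrder n0 N ℓ deg0 D)) g
lemma4p1 n0 N ℓ deg0 D g = begin
  mass (run timeOrder) g                   ≡⟨ mass-run g timeOrder ⟩
  massFrom g timeOrder empty (+ 1 / 1)     ≡⟨ timeOrder≈sortedOrder g (+ 1 / 1) ⟩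
  massFrom g sortedOrder empty (+ 1 / 1)   ≡⟨ mass-run g sortedOrder ⟨
  mass (run sortedOrder) g                 ∎
  where
  open PA n0 N ℓ deg0 D
  open Fulfilment n0 N ℓ deg0 D
  open ≡-Reasoning
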